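{- Let $G=(V,E)$ be a connected loopless graph with weights $w\in\mathbb{Q}_{\ge0}^E$ and a partition of $E$ into safe edges $\overline F$ and unsafe edges $F$. Then each unsafe edge $f\in F$ has a lower threshold $\alpha_f\in[0,1]\cup\{\infty\}$, and each safe edge $e\in\overline F$ has an upper threshold $\alpha_e\in[0,1]$.
   Context: For $\alpha\in[0,1]$ let $w_\alpha(e)=\alpha w(e)$ if $e\in\overline F$ and $w_\alpha(e)=w(e)$ otherwise. An $\alpha$-MST is a spanning tree of $G$ of minimum $w_\alpha$-weight. For $e\in E$, $\alpha_e\in[0,1]$ is a lower threshold for $e$ if for every $\alpha\in[0,1]$ there is an $\alpha$-MST containing $e$ if and only if $\alpha\ge\alpha_e$; if $e$ is in no $\alpha$-MST for all $\alpha\in[0,1]$, the lower threshold of $e$ is defined to be $\infty$. A value $\alpha_e\in[0,1]$ is an upper threshold for $e$ if for every $\alpha\in[0,1]$ there is an $\alpha$-MST containing $e$ if and only if $\alpha\le\alpha_e$.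
   Formalization: The parameter α and the finite thresholds $\alpha_f$ and $\alpha_e$ range over the rationals in [0,1]. -}

module Defs where

open import Data.Nat using (ℕ)
open import Data.Fin using (Fin; zero; suc)
open import Data.Bool using (Bool; true; false; if_then_else_)
open import Data.Product using (_×_; _,_; ∃; ∃-syntax; Σ)
open import Data.Sum using (_⊎_)
open import Relation.Binary.PropositionalEquality using (_≡_)
open import Relation.Nullary using (¬_)
open import Data.Rational using (ℚ; 0ℚ; 1ℚ; _+_; _*_; _≤_)

record Graph : Set where
  field
    n    : ℕ
    m    : ℕ
    src  : Fin m → Fin n
    tgt  : Fin m → Fin n

open Graph public

Loopless : Graph → Set
Loopless G = ∀ e → ¬ (src G e ≡ tgt G e)

EdgeSet : Graph → Set
EdgeSet G = Fin (m G) → Bool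

_∈E_ : ∀ {k : ℕ} → Fin k → (Fin k → Bool) → Set
e ∈E S = S e ≡ true

allEdges : (G : Graph) → EdgeSet G
allEdges G _ = true

removeEdge : (G : Graph) → EdgeSet G → Fin (m G) → EdgeSet G
removeEdge G S e f with e Data.Fin.≟ f
... | Relation.Nullary.yes _ = false
... | Relation.Nullary.no  _ = S f

data Reach (G : Graph) (S : EdgeSet G) : Fin (n G) → Fin (n G) → Set where
  here  : ∀ {u} → Reach G S u u
  fwd   : ∀ {u v} e → e ∈E S → Reach G S (tgt G e) v → src G e ≡ u → Reach G S u v
  bwd   : ∀ {u v} e → e ∈E S → Reach G S (src G e) v → tgt G e ≡ u → Reach G S u v

ConnectedBy : (G : Graph) → EdgeSet G → Set
ConnectedBy G S = ∀ u v → Reach G S u v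

Connected : Graph → Set
Connected G = ConnectedBy G (allEdges G)

Acyclic : (G : Graph) → EdgeSet G → Set
Acyclic G S = ∀ e → e ∈E S → ¬ Reach G (removeEdge G S e) (src G e) (tgt G e)

SpanningTree : (G : Graph) → EdgeSet G → Set
SpanningTree G T = ConnectedBy G T × Acyclic G T

sumFin : ∀ {k : ℕ} → (Fin k → ℚ) → ℚ
sumFin {ℕ.zero}  f = 0ℚ
sumFin {ℕ.suc k} f = f zero + sumFin (λ i → f (suc i))

-- Weights w, safe-edge indicator (true = safe edge in F̄, false = unsafe edge in F)
module _ (G : Graph) (w : Fin (m G) → ℚ) (safe : Fin (m G) → Bool) where

  wα : ℚ → Fin (m G) → ℚ
  wα α e = if safe e then α * w e else w e

  weight : ℚ → EdgeSet G → ℚ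
  weight α T = sumFin (λ e → if T e then wα α e else 0ℚ)

  IsαMST : ℚ → EdgeSet G → Set
  IsαMST α T = SpanningTree G T × (∀ T' → SpanningTree G T' → weight α T ≤ weight α T')

  InMST : ℚ → Fin (m G) → Set
  InMST α e = ∃[ T ] (IsαMST α T × e ∈E T)

  InUnit : ℚ → Set
  InUnit α = 0ℚ ≤ α × α ≤ 1ℚ

  LowerThreshold : Fin (m G) → ℚ → Set
  LowerThreshold e a = InUnit a ×
    (∀ α → InUnit α → (InMST α e → a ≤ α) × (a ≤ α → InMST α e))

  -- lower threshold ∞: e lies in no α-MST for any α ∈ [0,1]
  LowerThresholdInfinite : Fin (m G) → Set
  LowerThresholdInfinite e = ∀ α → InUnit α → ¬ InMST α e

  UpperThreshold : Fin (m G) → ℚ → Set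
  UpperThreshold e a = InUnit a ×
    (∀ α → InUnit α → (InMST α e → α ≤ a) × (α ≤ a → InMST α e))

-- For fixed α, an edge e lies in some α-MST iff its endpoints are not joined by edges that are
-- strictly w_α-lighter than e (the cycle property, proved by exchanging tree edges).  Both
-- weights are affine in α, so for every other edge x the set of α ∈ [0,1] at which x is lighter
-- than e is an interval: (c_x, 1] if e is safe and [0, c_x) if e is unsafe.  Hence the subgraph
-- of lighter edges grows (resp. shrinks) with α, and the endpoints of e are joined in it exactly
-- beyond (resp. below) a bottleneck value: the least over connecting paths of the largest c_x on
-- the path (resp. the greatest over paths of the smallest c_x).  Clipped to [0,1] this is the
-- threshold of e; for an unsafe edge whose bottleneck exceeds 1 the endpoints stay joined for
-- every α, so e is in no α-MST and its threshold is ∞.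
module Submission where

open import Defs
open import Algebra.Bundles using (CommutativeMonoid)
open import Data.Bool using (Bool; true; false; if_then_else_)
import Data.Bool.Properties as Bool
open import Data.Fin using (Fin; zero; suc; _≟_)
open import Data.Fin.Properties using (all?; suc-injective)
open import Data.List using (List; []; _∷_; _++_; map; filter; foldl; allFin)
open import Data.List.Membership.Propositional using (_∈_)
open import Data.List.Membership.Propositional.Properties
  using (∈-allFin; ∈-filter⁺; ∈-filter⁻; ∈-map⁺; ∈-++⁺ˡ; ∈-++⁺ʳ)
open import Data.List.Relation.Unary.All using (lookup)
open import Data.List.Relation.Unary.All.Properties using (all-filter)
open import Data.List.Relation.Unary.Any using (here; there)
open import Data.Nat using (ℕ)
open import Data.Product using (_×_; _,_; ∃-syntax; proj₁; proj₂)
open import Data.Rational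
  using (ℚ; 0ℚ; 1ℚ; _+_; _*_; _÷_; _≤_; _<_; _⊓_; Positive; positive; nonNegative)
open import Data.Rational.Properties
  using (≤-refl; ≤-trans; ≤-antisym; <-irrefl; <-≤-trans; ≤-<-trans; <⇒≤; ≮⇒≥; ≰⇒>;
         _≤?_; _<?_; ≤-decTotalOrder; +-assoc; +-identityʳ; +-0-commutativeMonoid;
         +-mono-<-≤; +-mono-≤-<; *-assoc; *-identityʳ; *-inverseˡ; *-zeroˡ; *-zeroʳ;
         *-cancelʳ-≤-pos; *-cancelʳ-<-nonNeg; *-cancelˡ-<-nonNeg; *-monoˡ-<-pos; *-monoʳ-<-pos;
         *-monoˡ-≤-nonNeg; pos⇒nonZero; pos⇒nonNeg; ⊓-glb; p⊓q≤p; p⊓q≤q)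
open import Data.Sum using (_⊎_; inj₁; inj₂)
open import Data.Vec.Functional using () renaming ([] to []ᶠ; _∷_ to _∷ᶠ_)
open import Function using (_∘_; _⇔_; mk⇔; Equivalence)
open import Function.Construct.Composition using (_⇔-∘_)
open import Relation.Binary.Bundles using (DecTotalOrder)
import Relation.Binary.Construct.Flip.EqAndOrd as Flip
open import Relation.Binary.PropositionalEquality
open import Relation.Nullary using (¬_; Dec; yes; no; does; contradiction)
open import Relation.Nullary.Decidable
  using (map′; dec-true; toWitness; _×-dec_; _⊎-dec_; _→-dec_; ¬?)
open import Algebra.Properties.CommutativeSemigroup
  (CommutativeMonoid.commutativeSemigroup +-0-commutativeMonoid) using (xy∙z≈zy∙x; xy∙z≈xz∙y)

dec-true⁻ : ∀ {a} {A : Set a} (a? : Dec A) → does a? ≡ true → A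
dec-true⁻ (yes a) _ = a

dec-false⁻ : ∀ {a} {A : Set a} (a? : Dec A) → does a? ≡ false → ¬ A
dec-false⁻ (no ¬a) _ = ¬a

module Walks (G : Graph) where

  private
    variable
      S S′ T : EdgeSet G
      u v z : Fin (n G)
      x y : Fin (m G)

  infix 4 _⊆_
  _⊆_ : EdgeSet G → EdgeSet G → Set
  S ⊆ S′ = ∀ x → x ∈E S → x ∈E S′

  ⊆-trans : S ⊆ S′ → S′ ⊆ T → S ⊆ T
  ⊆-trans S⊆S′ S′⊆T x = S′⊆T x ∘ S⊆S′ x

  ≗⇒⊆ : S ≗ S′ → S ⊆ S′
  ≗⇒⊆ S≗S′ x x∈ = trans (sym (S≗S′ x)) x∈

  addEdge : EdgeSet G → Fin (m G) → EdgeSet G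
  addEdge S y x with y ≟ x
  ... | yes _ = true
  ... | no  _ = S x

  removeEdge-self : ∀ S y → removeEdge G S y y ≡ false
  removeEdge-self S y with y ≟ y
  ... | yes _ = refl
  ... | no y≢y = contradiction refl y≢y

  removeEdge-other : ∀ S → y ≢ x → removeEdge G S y x ≡ S x
  removeEdge-other {y} {x} S y≢x with y ≟ x
  ... | yes y≡x = contradiction y≡x y≢x
  ... | no  _   = refl

  removeEdge-⊆ : ∀ S y → removeEdge G S y ⊆ S
  removeEdge-⊆ S y x x∈ with y ≟ x
  ... | no _ = x∈

  removeEdge-≢ : ∀ S y → x ∈E removeEdge G S y → y ≢ x
  removeEdge-≢ {x} S y x∈ with y ≟ x
  ... | no y≢x = y≢x

  removeEdge-absent : ∀ S y → S x ≡ false → removeEdge G S y x ≡ false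
  removeEdge-absent {x} S y x∉ with removeEdge G S y x in x∈?
  ... | false = refl
  ... | true  = trans (sym (removeEdge-⊆ S y x x∈?)) x∉

  removeEdge-mono : ∀ y → S ⊆ S′ → removeEdge G S y ⊆ removeEdge G S′ y
  removeEdge-mono {S} {S′} y S⊆S′ x x∈ =
    trans (removeEdge-other S′ (removeEdge-≢ S y x∈)) (S⊆S′ x (removeEdge-⊆ S y x x∈))

  addEdge-self : ∀ S y → y ∈E addEdge S y
  addEdge-self S y with y ≟ y
  ... | yes _ = refl
  ... | no y≢y = contradiction refl y≢y

  addEdge-other : ∀ S → y ≢ x → addEdge S y x ≡ S x
  addEdge-other {y} {x} S y≢x with y ≟ x
  ... | yes y≡x = contradiction y≡x y≢x
  ... | no  _   = refl

  addEdge-⊇ : ∀ S y → S ⊆ addEdge S y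
  addEdge-⊇ S y x x∈ with y ≟ x
  ... | yes _ = refl
  ... | no  _ = x∈

  addEdge-∈ : ∀ S y x → x ∈E addEdge S y → y ≢ x → x ∈E S
  addEdge-∈ S y x x∈ y≢x = trans (sym (addEdge-other S y≢x)) x∈

  removeEdge-addEdge : ∀ S y → removeEdge G (addEdge S y) y ⊆ S
  removeEdge-addEdge S y x x∈ =
    addEdge-∈ S y x (removeEdge-⊆ _ y x x∈) (removeEdge-≢ _ y x∈)

  removeEdge-swap : ∀ S y z → removeEdge G (removeEdge G S y) z ⊆ removeEdge G (removeEdge G S z) y
  removeEdge-swap S y z x x∈ =
    trans (removeEdge-other _ (removeEdge-≢ _ y x∈′))
          (trans (removeEdge-other S (removeEdge-≢ _ z x∈)) (removeEdge-⊆ S y x x∈′))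
    where
      x∈′ : x ∈E removeEdge G S y
      x∈′ = removeEdge-⊆ _ z x x∈

  Reach-mono : S ⊆ S′ → Reach G S u v → Reach G S′ u v
  Reach-mono S⊆S′ here            = here
  Reach-mono S⊆S′ (fwd x x∈ r eq) = fwd x (S⊆S′ x x∈) (Reach-mono S⊆S′ r) eq
  Reach-mono S⊆S′ (bwd x x∈ r eq) = bwd x (S⊆S′ x x∈) (Reach-mono S⊆S′ r) eq

  Reach-trans : Reach G S u z → Reach G S z v → Reach G S u v
  Reach-trans here            r′ = r′
  Reach-trans (fwd x x∈ r eq) r′ = fwd x x∈ (Reach-trans r r′) eq
  Reach-trans (bwd x x∈ r eq) r′ = bwd x x∈ (Reach-trans r r′) eq

  Reach-edge : x ∈E S → Reach G S (src G x) (tgt G x)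
  Reach-edge {x} x∈ = fwd x x∈ here refl

  Reach-sym : Reach G S u v → Reach G S v u
  Reach-sym here               = here
  Reach-sym (fwd x x∈ r refl) = Reach-trans (Reach-sym r) (bwd x x∈ here refl)
  Reach-sym (bwd x x∈ r refl) = Reach-trans (Reach-sym r) (Reach-edge x∈)

  Via : EdgeSet G → Fin (m G) → Fin (n G) → Fin (n G) → Set
  Via S y u v = Reach G S u v ⊎ (Reach G S u (src G y) × Reach G S (tgt G y) v)
                              ⊎ (Reach G S u (tgt G y) × Reach G S (src G y) v)

  pattern avoiding r     = inj₁ r
  pattern forwards p q  = inj₂ (inj₁ (p , q))
  pattern backwards p q = inj₂ (inj₂ (p , q))

  Via? : (∀ p q → Dec (Reach G S p q)) → ∀ y u v → Dec (Via S y u v)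
  Via? R? y u v =
    R? u v ⊎-dec ((R? u (src G y) ×-dec R? (tgt G y) v) ⊎-dec (R? u (tgt G y) ×-dec R? (src G y) v))

  Via-mono : S ⊆ S′ → Via S y u v → Via S′ y u v
  Via-mono S⊆S′ (avoiding r)    = avoiding (Reach-mono S⊆S′ r)
  Via-mono S⊆S′ (forwards p q)  = forwards (Reach-mono S⊆S′ p) (Reach-mono S⊆S′ q)
  Via-mono S⊆S′ (backwards p q) = backwards (Reach-mono S⊆S′ p) (Reach-mono S⊆S′ q)

  Via-prepend : Reach G S u z → Via S y z v → Via S y u v
  Via-prepend p (avoiding r)    = avoiding (Reach-trans p r)
  Via-prepend p (forwards q r)  = forwards (Reach-trans p q) r
  Via-prepend p (backwards q r) = backwards (Reach-trans p q) r

  Via-close : Reach G S (src G y) (tgt G y) → Via S y u v → Reach G S u v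
  Via-close link (avoiding r)    = r
  Via-close link (forwards p q)  = Reach-trans p (Reach-trans link q)
  Via-close link (backwards p q) = Reach-trans p (Reach-trans (Reach-sym link) q)

  split : ∀ y → Reach G S u v → Via (removeEdge G S y) y u v
  split y here = avoiding here
  split {S} y (fwd x x∈ r refl) with y ≟ x | split y r
  ... | yes refl | avoiding r′    = forwards here r′
  ... | yes refl | forwards _ r′  = forwards here r′
  ... | yes refl | backwards _ r′ = avoiding r′
  ... | no y≢x   | via            =
    Via-prepend (Reach-edge (trans (removeEdge-other S y≢x) x∈)) via
  split {S} y (bwd x x∈ r refl) with y ≟ x | split y r
  ... | yes refl | avoiding r′    = backwards here r′
  ... | yes refl | forwards _ r′  = avoiding r′
  ... | yes refl | backwards _ r′ = backwards here r′
  ... | no y≢x   | via            =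
    Via-prepend (Reach-sym (Reach-edge (trans (removeEdge-other S y≢x) x∈))) via

  reroute : removeEdge G S y ⊆ T → Reach G T (src G y) (tgt G y) → Reach G S u v → Reach G T u v
  reroute {y = y} S−y⊆T link = Via-close link ∘ Via-mono S−y⊆T ∘ split y

  edge-endpoints-joined : removeEdge G S y ⊆ T → Reach G T u v → ¬ Reach G (removeEdge G S y) u v →
                          Reach G S u v → Reach G T (src G y) (tgt G y)
  edge-endpoints-joined {y = y} S−y⊆T t ¬r r with split y r
  ... | avoiding r′   = contradiction r′ ¬r
  ... | forwards p q  =
    Reach-trans (Reach-sym (Reach-mono S−y⊆T p)) (Reach-trans t (Reach-sym (Reach-mono S−y⊆T q)))
  ... | backwards p q =
    Reach-trans (Reach-mono S−y⊆T q) (Reach-trans (Reach-sym t) (Reach-mono S−y⊆T p))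

  infixl 30 _∩_
  _∩_ : EdgeSet G → List (Fin (m G)) → EdgeSet G
  (S ∩ [])       x = false
  (S ∩ (y ∷ ys)) x with y ≟ x
  ... | yes _ = S x
  ... | no  _ = (S ∩ ys) x

  ∩-⊆ : ∀ S ys → S ∩ ys ⊆ S
  ∩-⊆ S (y ∷ ys) x x∈ with y ≟ x
  ... | yes _ = x∈
  ... | no  _ = ∩-⊆ S ys x x∈

  ∩-∷ : ∀ S y ys → S ∩ ys ⊆ S ∩ (y ∷ ys)
  ∩-∷ S y ys x x∈ with y ≟ x
  ... | yes _ = ∩-⊆ S ys x x∈
  ... | no  _ = x∈

  ∩-∷-absent : ∀ S y ys → S y ≡ false → S ∩ (y ∷ ys) ⊆ S ∩ ys
  ∩-∷-absent S y ys y∉ x x∈ with y ≟ x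
  ... | yes refl = contradiction (trans (sym y∉) x∈) λ ()
  ... | no  _    = x∈

  ∩-head : ∀ S y ys → y ∈E S → y ∈E S ∩ (y ∷ ys)
  ∩-head S y ys y∈ with y ≟ y
  ... | yes _   = y∈
  ... | no y≢y = contradiction refl y≢y

  removeEdge-∩-∷ : ∀ S y ys → removeEdge G (S ∩ (y ∷ ys)) y ⊆ S ∩ ys
  removeEdge-∩-∷ S y ys x x∈ with y ≟ x | removeEdge-≢ _ y x∈ | removeEdge-⊆ _ y x x∈
  ... | yes y≡x | y≢x | _   = contradiction y≡x y≢x
  ... | no  _   | _   | x∈′ = x∈′

  ∩-∈ : ∀ S ys → x ∈ ys → x ∈E S → x ∈E S ∩ ys
  ∩-∈ S (y ∷ ys) (here refl) x∈ = ∩-head S y ys x∈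
  ∩-∈ S (y ∷ ys) (there i)   x∈ = ∩-∷ S y ys _ (∩-∈ S ys i x∈)

  Reach-∩[] : ∀ S → Reach G (S ∩ []) u v → u ≡ v
  Reach-∩[] S here = refl

  Reach-∩? : ∀ S ys u v → Dec (Reach G (S ∩ ys) u v)
  Reach-∩? S [] u v = map′ (λ { refl → here }) (Reach-∩[] S) (u ≟ v)
  Reach-∩? S (y ∷ ys) u v with S y in y∈?
  ... | false = map′ (Reach-mono (∩-∷ S y ys)) (Reach-mono (∩-∷-absent S y ys y∈?))
                     (Reach-∩? S ys u v)
  ... | true  = map′ (Via-close (Reach-edge (∩-head S y ys y∈?)) ∘ Via-mono (∩-∷ S y ys))
                     (Via-mono (removeEdge-∩-∷ S y ys) ∘ split y)
                     (Via? (Reach-∩? S ys) y u v)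

  Reach? : ∀ S u v → Dec (Reach G S u v)
  Reach? S u v = map′ (Reach-mono (∩-⊆ S (allFin _)))
                      (Reach-mono λ x → ∩-∈ S (allFin _) (∈-allFin x))
                      (Reach-∩? S (allFin _) u v)

  crossing-edge : ¬ Reach G S′ u v → Reach G S u v →
                  ∃[ x ] (x ∈E S × ¬ Reach G S′ (src G x) (tgt G x))
  crossing-edge ¬r here = contradiction here ¬r
  crossing-edge {S′} ¬r (fwd x x∈ r refl) with Reach? S′ (src G x) (tgt G x)
  ... | no ¬rx = x , x∈ , ¬rx
  ... | yes rx = crossing-edge (λ r′ → ¬r (Reach-trans rx r′)) r
  crossing-edge {S′} ¬r (bwd x x∈ r refl) with Reach? S′ (src G x) (tgt G x)
  ... | no ¬rx = x , x∈ , ¬rx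
  ... | yes rx = crossing-edge (λ r′ → ¬r (Reach-trans (Reach-sym rx) r′)) r

  removeAll : EdgeSet G → List (Fin (m G)) → EdgeSet G
  removeAll = foldl (removeEdge G)

  removeAll-⊆ : ∀ S ys → removeAll S ys ⊆ S
  removeAll-⊆ S []       x x∈ = x∈
  removeAll-⊆ S (y ∷ ys) x x∈ = removeEdge-⊆ S y x (removeAll-⊆ _ ys x x∈)

  removeAll-removes : ∀ S ys → x ∈ ys → ¬ x ∈E removeAll S ys
  removeAll-removes S (y ∷ ys) (here refl) x∈ = removeEdge-≢ S y (removeAll-⊆ _ ys y x∈) refl
  removeAll-removes S (y ∷ ys) (there i)   x∈ = removeAll-removes _ ys i x∈

  disconnecting-edge : ∀ ys → Reach G S u v → ¬ Reach G (removeAll S ys) u v →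
                       ∃[ y ] (y ∈ ys × ∃[ S′ ] (S′ ⊆ S × Reach G S′ u v ×
                                                ¬ Reach G (removeEdge G S′ y) u v))
  disconnecting-edge [] r ¬r = contradiction r ¬r
  disconnecting-edge {S} {u} {v} (y ∷ ys) r ¬r with Reach? (removeEdge G S y) u v
  ... | no ¬r′ = y , here refl , S , (λ _ x∈ → x∈) , r , ¬r′
  ... | yes r′ with disconnecting-edge ys r′ ¬r
  ...   | y′ , i , S′ , S′⊆ , r″ , ¬r″ =
    y′ , there i , S′ , ⊆-trans S′⊆ (removeEdge-⊆ S y) , r″ , ¬r″

module SpanningTrees (G : Graph) where

  open Walks G

  private
    variable
      S T L : EdgeSet G
      u v : Fin (n G)
      x y : Fin (m G)

  exchange : SpanningTree G T → y ∈E T → ¬ Reach G (removeEdge G T y) (src G x) (tgt G x) →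
             SpanningTree G (addEdge (removeEdge G T y) x)
  exchange {T} {y} {x} (connected , acyclic) y∈T x-separated = connected′ , acyclic′
    where
      T−y : EdgeSet G
      T−y = removeEdge G T y
      T′ : EdgeSet G
      T′ = addEdge T−y x
      T−y⊆T′ : T−y ⊆ T′
      T−y⊆T′ = addEdge-⊇ T−y x
      y-joined : Reach G T′ (src G y) (tgt G y)
      y-joined = edge-endpoints-joined T−y⊆T′ (Reach-edge (addEdge-self T−y x)) x-separated
                                       (connected _ _)
      connected′ : ConnectedBy G T′
      connected′ p q = reroute T−y⊆T′ y-joined (connected p q)
      without-z-x⊆T−y : ∀ z → removeEdge G (removeEdge G T′ z) x ⊆ T−y
      without-z-x⊆T−y z =
        ⊆-trans (removeEdge-mono x (removeEdge-⊆ T′ z)) (removeEdge-addEdge T−y x)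
      without-z-x⊆T−z : ∀ z → removeEdge G (removeEdge G T′ z) x ⊆ removeEdge G T z
      without-z-x⊆T−z z = ⊆-trans (removeEdge-swap T′ z x)
        (removeEdge-mono z (⊆-trans (removeEdge-addEdge T−y x) (removeEdge-⊆ T y)))
      old-edge-separated : ∀ z → z ∈E T−y → ¬ Reach G (removeEdge G T′ z) (src G z) (tgt G z)
      old-edge-separated z z∈T−y cycle
        with Reach? (removeEdge G (removeEdge G T′ z) x) (src G z) (tgt G z)
      ... | yes r = acyclic z (removeEdge-⊆ T y z z∈T−y) (Reach-mono (without-z-x⊆T−z z) r)
      ... | no ¬r = x-separated
        (edge-endpoints-joined (without-z-x⊆T−y z) (Reach-edge z∈T−y) ¬r cycle)
      acyclic′ : Acyclic G T′
      acyclic′ z z∈ = acyclic-at (x ≟ z)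
        where
        acyclic-at : Dec (x ≡ z) → ¬ Reach G (removeEdge G T′ z) (src G z) (tgt G z)
        acyclic-at (yes refl) = x-separated ∘ Reach-mono (removeEdge-addEdge T−y x)
        acyclic-at (no x≢z)   = old-edge-separated z (addEdge-∈ T−y x z z∈ x≢z)

  pruneEdge : EdgeSet G → Fin (m G) → EdgeSet G
  pruneEdge S y with Reach? (removeEdge G S y) (src G y) (tgt G y)
  ... | yes _ = removeEdge G S y
  ... | no  _ = S

  prune : EdgeSet G → List (Fin (m G)) → EdgeSet G
  prune = foldl pruneEdge

  pruneEdge-⊆ : ∀ S y → pruneEdge S y ⊆ S
  pruneEdge-⊆ S y with Reach? (removeEdge G S y) (src G y) (tgt G y)
  ... | yes _ = removeEdge-⊆ S y
  ... | no  _ = λ _ x∈ → x∈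

  pruneEdge-connected : ∀ S y → ConnectedBy G S → ConnectedBy G (pruneEdge S y)
  pruneEdge-connected S y connected with Reach? (removeEdge G S y) (src G y) (tgt G y)
  ... | yes y-joined = λ p q → reroute (λ _ x∈ → x∈) y-joined (connected p q)
  ... | no  _        = connected

  prune-⊆ : ∀ S ys → prune S ys ⊆ S
  prune-⊆ S []       x x∈ = x∈
  prune-⊆ S (y ∷ ys) x x∈ = pruneEdge-⊆ S y x (prune-⊆ (pruneEdge S y) ys x x∈)

  prune-connected : ∀ S ys → ConnectedBy G S → ConnectedBy G (prune S ys)
  prune-connected S []       connected = connected
  prune-connected S (y ∷ ys) connected =
    prune-connected (pruneEdge S y) ys (pruneEdge-connected S y connected)

  prune-separates : ∀ S ys → y ∈ ys → y ∈E prune S ys →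
                    ¬ Reach G (removeEdge G (prune S ys) y) (src G y) (tgt G y)
  prune-separates S (y ∷ ys) (here refl) y∈ r with Reach? (removeEdge G S y) (src G y) (tgt G y)
  ... | yes _  = removeEdge-≢ S y (prune-⊆ (removeEdge G S y) ys y y∈) refl
  ... | no ¬r = ¬r (Reach-mono (removeEdge-mono y (prune-⊆ S ys)) r)
  prune-separates S (y′ ∷ ys) (there i) = prune-separates (pruneEdge S y′) ys i

  spanningTree-exists : Connected G → ∃[ T ] SpanningTree G T
  spanningTree-exists connected =
    prune (allEdges G) (allFin _) ,
    prune-connected (allEdges G) (allFin _) connected ,
    λ y → prune-separates (allEdges G) (allFin _) (∈-allFin y)

  SpanningTree? : ∀ T → Dec (SpanningTree G T)
  SpanningTree? T =
    all? (λ u → all? (λ v → Reach? T u v)) ×-dec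
    all? (λ e → (T e Bool.≟ true) →-dec ¬? (Reach? (removeEdge G T e) (src G e) (tgt G e)))

  SpanningTree-cong : S ≗ T → SpanningTree G S → SpanningTree G T
  SpanningTree-cong S≗T (connected , acyclic) =
    (λ u v → Reach-mono (≗⇒⊆ S≗T) (connected u v)) ,
    λ e e∈ → acyclic e (trans (S≗T e) e∈) ∘ Reach-mono (removeEdge-mono e (≗⇒⊆ (sym ∘ S≗T)))

  forest-bridge : Acyclic G T → S ⊆ T → y ∈E T →
                  Reach G S u v → ¬ Reach G (removeEdge G S y) u v → ¬ Reach G (removeEdge G T y) u v
  forest-bridge {y = y} acyclic S⊆T y∈T r ¬r r′ =
    acyclic y y∈T (edge-endpoints-joined (removeEdge-mono y S⊆T) r′ ¬r r)

  forest-path-leaves : Acyclic G T → Reach G T u v → ¬ Reach G L u v →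
                       ∃[ y ] (y ∈E T × L y ≡ false × ¬ Reach G (removeEdge G T y) u v)
  forest-path-leaves {T} {u} {v} {L} acyclic r ¬r =
    leaving-bridge (disconnecting-edge leaving r (¬r ∘ Reach-mono remaining⊆L))
    where
      leaving? : ∀ x → Dec (x ∈E T × L x ≡ false)
      leaving? x = (T x Bool.≟ true) ×-dec (L x Bool.≟ false)
      leaving : List (Fin (m G))
      leaving = filter leaving? (allFin _)
      remaining⊆L : removeAll T leaving ⊆ L
      remaining⊆L x x∈ with L x in x∉L?
      ... | true  = refl
      ... | false = contradiction x∈ (removeAll-removes T leaving
                      (∈-filter⁺ leaving? (∈-allFin x) (removeAll-⊆ T leaving x x∈ , x∉L?)))
      leaving-bridge : ∃[ y ] (y ∈ leaving × ∃[ S ] (S ⊆ T × Reach G S u v ×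
                                                      ¬ Reach G (removeEdge G S y) u v)) →
                       ∃[ y ] (y ∈E T × L y ≡ false × ¬ Reach G (removeEdge G T y) u v)
      leaving-bridge (y , i , S , S⊆T , r′ , ¬r′) with ∈-filter⁻ leaving? {xs = allFin _} i
      ... | _ , y∈T , y∉L = y , y∈T , y∉L , forest-bridge acyclic S⊆T y∈T r′ ¬r′
module Bottlenecks (G : Graph) {c ℓ₁ ℓ₂} (O : DecTotalOrder c ℓ₁ ℓ₂) where

  open DecTotalOrder O using ()
    renaming (Carrier to W; _≤_ to _≼_; _≤?_ to _≼?_; refl to ≼-refl; trans to ≼-trans;
              total to ≼-total; totalOrder to ≼-totalOrder)
  open Walks G
  import Data.List.Extrema ≼-totalOrder as Extrema

  private
    variable
      S : EdgeSet G
      u v z : Fin (n G)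

  AtMost : (Fin (m G) → W) → W → EdgeSet G
  AtMost t b x = does (t x ≼? b)

  AtMost-self : ∀ t x → x ∈E AtMost t (t x)
  AtMost-self t x = dec-true (t x ≼? t x) ≼-refl

  AtMost⁻ : ∀ t {b} x → x ∈E AtMost t b → t x ≼ b
  AtMost⁻ t {b} x = dec-true⁻ (t x ≼? b)

  AtMost-mono : ∀ t {b b′} → b ≼ b′ → AtMost t b ⊆ AtMost t b′
  AtMost-mono t {b′ = b′} b≼b′ x x∈ = dec-true (t x ≼? b′) (≼-trans (AtMost⁻ t x x∈) b≼b′)

  private
    prepend-heaviest : ∀ t {x} → x ∈E S → Reach G (AtMost t (t x)) u z →
                       z ≡ v ⊎ ∃[ y ] (y ∈E S × Reach G (AtMost t (t y)) z v) →
                       ∃[ y ] (y ∈E S × Reach G (AtMost t (t y)) u v)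
    prepend-heaviest t x∈ step (inj₁ refl) = _ , x∈ , step
    prepend-heaviest t {x} x∈ step (inj₂ (y , y∈ , r)) with ≼-total (t x) (t y)
    ... | inj₁ tx≼ty = y , y∈ , Reach-trans (Reach-mono (AtMost-mono t tx≼ty) step) r
    ... | inj₂ ty≼tx = x , x∈ , Reach-trans step (Reach-mono (AtMost-mono t ty≼tx) r)

  Reach-heaviest : ∀ t → Reach G S u v → u ≡ v ⊎ ∃[ x ] (x ∈E S × Reach G (AtMost t (t x)) u v)
  Reach-heaviest t here = inj₁ refl
  Reach-heaviest t (fwd x x∈ r refl) =
    inj₂ (prepend-heaviest t x∈ (Reach-edge (AtMost-self t x)) (Reach-heaviest t r))
  Reach-heaviest t (bwd x x∈ r refl) =
    inj₂ (prepend-heaviest t x∈ (Reach-sym (Reach-edge (AtMost-self t x))) (Reach-heaviest t r))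

  bottleneck : ∀ t → u ≢ v → Reach G (allEdges G) u v →
               ∃[ x₀ ] (Reach G (AtMost t (t x₀)) u v ×
                        (∀ {S} → Reach G S u v → ∃[ x ] (x ∈E S × t x₀ ≼ t x)))
  bottleneck {u} {v} t u≢v r with Reach-heaviest t r
  ... | inj₁ u≡v = contradiction u≡v u≢v
  ... | inj₂ (x₁ , _ , r₁) = x₀ , x₀-connects , lightest
    where
      connects? : ∀ x → Dec (Reach G (AtMost t (t x)) u v)
      connects? x = Reach? (AtMost t (t x)) u v
      candidates : List (Fin (m G))
      candidates = filter connects? (allFin _)
      x₀ : Fin (m G)
      x₀ = Extrema.argmin t x₁ candidates
      x₀-connects : Reach G (AtMost t (t x₀)) u v
      x₀-connects = Extrema.argmin-all t r₁ (all-filter connects? (allFin _))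
      lightest : Reach G S u v → ∃[ x ] (x ∈E S × t x₀ ≼ t x)
      lightest r with Reach-heaviest t r
      ... | inj₁ u≡v = contradiction u≡v u≢v
      ... | inj₂ (x , x∈ , rx) =
        x , x∈ , lookup (Extrema.f[argmin]≤f[xs] x₁ candidates)
                        (∈-filter⁺ connects? (∈-allFin x) rx)

subsets : ∀ k → List (Fin k → Bool)
subsets ℕ.zero    = []ᶠ ∷ []
subsets (ℕ.suc k) = map (true ∷ᶠ_) (subsets k) ++ map (false ∷ᶠ_) (subsets k)

subsets-complete : ∀ {k} (S : Fin k → Bool) → ∃[ S₀ ] (S₀ ∈ subsets k × S₀ ≗ S)
subsets-complete {ℕ.zero} S = []ᶠ , here refl , λ ()
subsets-complete {ℕ.suc k} S with subsets-complete (S ∘ suc) | S zero in S₀≡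
... | S₀ , S₀∈ , S₀≗ | true  =
  true ∷ᶠ S₀ , ∈-++⁺ˡ (∈-map⁺ (true ∷ᶠ_) S₀∈) , λ { zero → sym S₀≡ ; (suc i) → S₀≗ i }
... | S₀ , S₀∈ , S₀≗ | false =
  false ∷ᶠ S₀ , ∈-++⁺ʳ (map (true ∷ᶠ_) (subsets k)) (∈-map⁺ (false ∷ᶠ_) S₀∈) ,
  λ { zero → sym S₀≡ ; (suc i) → S₀≗ i }

sumFin-cong : ∀ {k} {f g : Fin k → ℚ} → f ≗ g → sumFin f ≡ sumFin g
sumFin-cong {ℕ.zero}  f≗g = refl
sumFin-cong {ℕ.suc k} f≗g = cong₂ _+_ (f≗g zero) (sumFin-cong (f≗g ∘ suc))

sumFin-update : ∀ {k} (f g : Fin k → ℚ) i → (∀ j → j ≢ i → f j ≡ g j) →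
                sumFin f + g i ≡ sumFin g + f i
sumFin-update {ℕ.suc k} f g zero f≡g = begin
  (f zero + sumFin (f ∘ suc)) + g zero
    ≡⟨ cong (λ s → (f zero + s) + g zero) (sumFin-cong λ j → f≡g (suc j) λ ()) ⟩
  (f zero + sumFin (g ∘ suc)) + g zero
    ≡⟨ xy∙z≈zy∙x (f zero) _ (g zero) ⟩
  (g zero + sumFin (g ∘ suc)) + f zero ∎
  where open ≡-Reasoning
sumFin-update {ℕ.suc k} f g (suc i) f≡g = begin
  (f zero + sumFin (f ∘ suc)) + g (suc i)
    ≡⟨ +-assoc (f zero) _ _ ⟩
  f zero + (sumFin (f ∘ suc) + g (suc i))
    ≡⟨ cong₂ _+_ (f≡g zero λ ())
                 (sumFin-update (f ∘ suc) (g ∘ suc) i λ j j≢i → f≡g (suc j) (j≢i ∘ suc-injective)) ⟩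
  g zero + (sumFin (g ∘ suc) + f (suc i))
    ≡⟨ +-assoc (g zero) _ _ ⟨
  (g zero + sumFin (g ∘ suc)) + f (suc i) ∎
  where open ≡-Reasoning

+-≡-cancel-≤ : ∀ {p q r s : ℚ} → p + r ≡ q + s → s ≤ r → p ≤ q
+-≡-cancel-≤ eq s≤r = ≮⇒≥ λ q<p → <-irrefl (sym eq) (+-mono-<-≤ q<p s≤r)

+-≡-cancel-< : ∀ {p q r s : ℚ} → p + r ≡ q + s → s < r → p < q
+-≡-cancel-< eq s<r = ≰⇒> λ q≤p → <-irrefl (sym eq) (+-mono-≤-< q≤p s<r)

module MinimumSpanningTrees (G : Graph) (c : Fin (m G) → ℚ) where

  open Walks G
  open SpanningTrees G
  import Data.List.Extrema (DecTotalOrder.totalOrder ≤-decTotalOrder) as Extrema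

  private
    variable
      S T : EdgeSet G
      x y e : Fin (m G)

  weightIf : Bool → Fin (m G) → ℚ
  weightIf b x = if b then c x else 0ℚ

  totalWeight : EdgeSet G → ℚ
  totalWeight T = sumFin (λ x → weightIf (T x) x)

  IsMST : EdgeSet G → Set
  IsMST T = SpanningTree G T × (∀ T′ → SpanningTree G T′ → totalWeight T ≤ totalWeight T′)

  InSomeMST : Fin (m G) → Set
  InSomeMST e = ∃[ T ] (IsMST T × e ∈E T)

  weightIf-cong : ∀ x {b b′} → b ≡ b′ → weightIf b x ≡ weightIf b′ x
  weightIf-cong x = cong (λ b → weightIf b x)

  totalWeight-cong : S ≗ T → totalWeight S ≡ totalWeight T
  totalWeight-cong S≗T = sumFin-cong (λ x → weightIf-cong x (S≗T x))

  totalWeight-removeEdge : ∀ T y → y ∈E T → totalWeight (removeEdge G T y) + c y ≡ totalWeight T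
  totalWeight-removeEdge T y y∈T = begin
    totalWeight (removeEdge G T y) + c y
      ≡⟨ cong (totalWeight (removeEdge G T y) +_) (weightIf-cong y y∈T) ⟨
    totalWeight (removeEdge G T y) + weightIf (T y) y
      ≡⟨ sumFin-update _ _ y (λ x x≢y → weightIf-cong x (removeEdge-other T (x≢y ∘ sym))) ⟩
    totalWeight T + weightIf (removeEdge G T y y) y
      ≡⟨ cong (totalWeight T +_) (weightIf-cong y (removeEdge-self T y)) ⟩
    totalWeight T + 0ℚ
      ≡⟨ +-identityʳ _ ⟩
    totalWeight T ∎
    where open ≡-Reasoning

  totalWeight-addEdge : ∀ S x → S x ≡ false → totalWeight (addEdge S x) ≡ totalWeight S + c x
  totalWeight-addEdge S x x∉S = begin
    totalWeight (addEdge S x)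
      ≡⟨ +-identityʳ _ ⟨
    totalWeight (addEdge S x) + 0ℚ
      ≡⟨ cong (totalWeight (addEdge S x) +_) (weightIf-cong x x∉S) ⟨
    totalWeight (addEdge S x) + weightIf (S x) x
      ≡⟨ sumFin-update _ _ x (λ y y≢x → weightIf-cong y (addEdge-other S (y≢x ∘ sym))) ⟩
    totalWeight S + weightIf (addEdge S x x) x
      ≡⟨ cong (totalWeight S +_) (weightIf-cong x (addEdge-self S x)) ⟩
    totalWeight S + c x ∎
    where open ≡-Reasoning

  totalWeight-exchange : y ∈E T → T x ≡ false →
                         totalWeight (addEdge (removeEdge G T y) x) + c y ≡ totalWeight T + c x
  totalWeight-exchange {y} {T} {x} y∈T x∉T = begin
    totalWeight (addEdge (removeEdge G T y) x) + c y
      ≡⟨ cong (_+ c y) (totalWeight-addEdge _ x (removeEdge-absent T y x∉T)) ⟩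
    (totalWeight (removeEdge G T y) + c x) + c y
      ≡⟨ xy∙z≈xz∙y (totalWeight (removeEdge G T y)) (c x) (c y) ⟩
    (totalWeight (removeEdge G T y) + c y) + c x
      ≡⟨ cong (_+ c x) (totalWeight-removeEdge T y y∈T) ⟩
    totalWeight T + c x ∎
    where open ≡-Reasoning

  mst-exists : Connected G → ∃[ T ] IsMST T
  mst-exists connected with spanningTree-exists connected
  ... | T₀ , T₀-tree = cheapest , cheapest-tree , minimal
    where
      trees : List (EdgeSet G)
      trees = filter SpanningTree? (subsets (m G))
      cheapest : EdgeSet G
      cheapest = Extrema.argmin totalWeight T₀ trees
      cheapest-tree : SpanningTree G cheapest
      cheapest-tree = Extrema.argmin-all totalWeight T₀-tree (all-filter SpanningTree? (subsets (m G)))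
      minimal : ∀ T′ → SpanningTree G T′ → totalWeight cheapest ≤ totalWeight T′
      minimal T′ T′-tree with subsets-complete T′
      ... | T₁ , T₁∈ , T₁≗T′ = subst (totalWeight cheapest ≤_) (totalWeight-cong T₁≗T′)
        (lookup (Extrema.f[argmin]≤f[xs] T₀ trees)
                (∈-filter⁺ SpanningTree? T₁∈ (SpanningTree-cong (sym ∘ T₁≗T′) T′-tree)))

  Lighter : Fin (m G) → EdgeSet G
  Lighter e x = does (c x <? c e)

  ∈Lighter⇔ : x ∈E Lighter e ⇔ c x < c e
  ∈Lighter⇔ {x} {e} = mk⇔ (dec-true⁻ (c x <? c e)) (dec-true (c x <? c e))

  InSomeMST⇒no-lighter-path : InSomeMST e → ¬ Reach G (Lighter e) (src G e) (tgt G e)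
  InSomeMST⇒no-lighter-path {e} (T , (T-tree@(_ , acyclic) , minimal) , e∈T) r
    with crossing-edge (acyclic e e∈T) r
  ... | x , x-lighter , x-separated =
    <-irrefl refl (<-≤-trans lighter (minimal _ (exchange T-tree e∈T x-separated)))
    where
      cx<ce : c x < c e
      cx<ce = Equivalence.to ∈Lighter⇔ x-lighter
      x∉T : T x ≡ false
      x∉T with T x in x∈T?
      ... | false = refl
      ... | true  = contradiction (Reach-edge (trans (removeEdge-other T e≢x) x∈T?)) x-separated
        where
          e≢x : e ≢ x
          e≢x refl = <-irrefl refl cx<ce
      lighter : totalWeight (addEdge (removeEdge G T e) x) < totalWeight T
      lighter = +-≡-cancel-< (totalWeight-exchange e∈T x∉T) cx<ce

  no-lighter-path⇒InSomeMST : Connected G → ¬ Reach G (Lighter e) (src G e) (tgt G e) → InSomeMST e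
  no-lighter-path⇒InSomeMST {e} connected ¬r with mst-exists connected
  ... | T , T-mst@(T-tree@(T-connected , acyclic) , minimal) with T e in e∈T?
  ...   | true  = T , T-mst , e∈T?
  ...   | false with forest-path-leaves acyclic (T-connected _ _) ¬r
  ...     | y , y∈T , y-heavy , y-separates =
    addEdge (removeEdge G T y) e ,
    (exchange T-tree y∈T y-separates , λ T′ T′-tree → ≤-trans no-heavier (minimal T′ T′-tree)) ,
    addEdge-self _ e
    where
      no-heavier : totalWeight (addEdge (removeEdge G T y) e) ≤ totalWeight T
      no-heavier =
        +-≡-cancel-≤ (totalWeight-exchange y∈T e∈T?) (≮⇒≥ (dec-false⁻ (c y <? c e) y-heavy))

  InSomeMST⇔no-lighter-path : Connected G → InSomeMST e ⇔ (¬ Reach G (Lighter e) (src G e) (tgt G e))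
  InSomeMST⇔no-lighter-path connected =
    mk⇔ InSomeMST⇒no-lighter-path (no-lighter-path⇒InSomeMST connected)

<⇒≱ : ∀ {p q : ℚ} → p < q → ¬ q ≤ p
<⇒≱ p<q q≤p = <-irrefl refl (<-≤-trans p<q q≤p)

0≤1 : 0ℚ ≤ 1ℚ
0≤1 = toWitness {a? = 0ℚ ≤? 1ℚ} _

1<2 : 1ℚ < 1ℚ + 1ℚ
1<2 = toWitness {a? = 1ℚ <? 1ℚ + 1ℚ} _

module _ (d : ℚ) .{{_ : Positive d}} where

  private
    instance
      d≢0 = pos⇒nonZero d
      d≥0 = pos⇒nonNeg d

  ÷-*-cancel : ∀ a → (a ÷ d) * d ≡ a
  ÷-*-cancel a = trans (*-assoc a _ d) (trans (cong (a *_) (*-inverseˡ d)) (*-identityʳ a))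

  ÷-nonNeg : ∀ {a} → 0ℚ ≤ a → 0ℚ ≤ a ÷ d
  ÷-nonNeg {a} 0≤a = *-cancelʳ-≤-pos d (subst₂ _≤_ (sym (*-zeroˡ d)) (sym (÷-*-cancel a)) 0≤a)

  <*⇔÷< : ∀ {a α} → a < α * d ⇔ a ÷ d < α
  <*⇔÷< {a} {α} = mk⇔ (*-cancelʳ-<-nonNeg d ∘ subst (_< α * d) (sym (÷-*-cancel a)))
                      (subst (_< α * d) (÷-*-cancel a) ∘ *-monoˡ-<-pos d)

  *<⇔<÷ : ∀ {a α} → α * d < a ⇔ α < a ÷ d
  *<⇔<÷ {a} {α} = mk⇔ (*-cancelʳ-<-nonNeg d ∘ subst (α * d <_) (sym (÷-*-cancel a)))
                      (subst (α * d <_) (÷-*-cancel a) ∘ *-monoˡ-<-pos d)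

HoldsAbove HoldsBelow HoldsUpTo HoldsFrom : ℚ → (ℚ → Set) → Set
HoldsAbove c P = ∀ α → 0ℚ ≤ α → α ≤ 1ℚ → (P α ⇔ c < α)
HoldsBelow c P = ∀ α → 0ℚ ≤ α → α ≤ 1ℚ → (P α ⇔ α < c)
HoldsUpTo  a P = ∀ α → 0ℚ ≤ α → α ≤ 1ℚ → (P α ⇔ α ≤ a)
HoldsFrom  a P = ∀ α → 0ℚ ≤ α → α ≤ 1ℚ → (P α ⇔ a ≤ α)

HoldsAboveSome HoldsBelowSome : (ℚ → Set) → Set
HoldsAboveSome P = ∃[ c ] (0ℚ ≤ c × HoldsAbove c P)
HoldsBelowSome P = ∃[ c ] (0ℚ ≤ c × HoldsBelow c P)

private
  variable
    P Q : ℚ → Set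

HoldsAboveSome-resp : (∀ α → P α ⇔ Q α) → HoldsAboveSome Q → HoldsAboveSome P
HoldsAboveSome-resp P⇔Q (c , 0≤c , holds) = c , 0≤c , λ α 0≤α α≤1 → holds α 0≤α α≤1 ⇔-∘ P⇔Q α

HoldsBelowSome-resp : (∀ α → P α ⇔ Q α) → HoldsBelowSome Q → HoldsBelowSome P
HoldsBelowSome-resp P⇔Q (c , 0≤c , holds) = c , 0≤c , λ α 0≤α α≤1 → holds α 0≤α α≤1 ⇔-∘ P⇔Q α

never-holdsAbove : (∀ α → 0ℚ ≤ α → ¬ P α) → HoldsAboveSome P
never-holdsAbove ¬P = 1ℚ , 0≤1 , λ α 0≤α α≤1 →
  mk⇔ (λ Pα → contradiction Pα (¬P α 0≤α)) (λ 1<α → contradiction α≤1 (<⇒≱ 1<α))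

constant-holdsBelow : ∀ {A : Set} → Dec A → (∀ α → P α ⇔ A) → HoldsBelowSome P
constant-holdsBelow (yes a) P⇔A = 1ℚ + 1ℚ , ≤-trans 0≤1 (<⇒≤ 1<2) , λ α _ α≤1 →
  mk⇔ (λ _ → ≤-<-trans α≤1 1<2) (λ _ → Equivalence.from (P⇔A α) a)
constant-holdsBelow (no ¬a) P⇔A = 0ℚ , ≤-refl , λ α 0≤α _ →
  mk⇔ (λ Pα → contradiction (Equivalence.to (P⇔A α) Pα) ¬a) (λ α<0 → contradiction 0≤α (<⇒≱ α<0))

scaled<scaled-holdsAbove : ∀ p q → HoldsAboveSome (λ α → α * p < α * q)
scaled<scaled-holdsAbove p q with p <? q
... | yes p<q = 0ℚ , ≤-refl , λ α 0≤α _ →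
  mk⇔ (scale-positive 0≤α) (λ 0<α → *-monoʳ-<-pos α {{positive 0<α}} p<q)
  where
    scale-positive : ∀ {α} → 0ℚ ≤ α → α * p < α * q → 0ℚ < α
    scale-positive {α} 0≤α αp<αq = ≰⇒> λ α≤0 → <-irrefl (trans (*-zeroˡ p) (sym (*-zeroˡ q)))
      (subst (λ β → β * p < β * q) (≤-antisym α≤0 0≤α) αp<αq)
... | no p≮q = never-holdsAbove λ α 0≤α αp<αq →
  p≮q (*-cancelˡ-<-nonNeg α {{nonNegative 0≤α}} αp<αq)

fixed<scaled-holdsAbove : ∀ {p} → 0ℚ ≤ p → ∀ q → HoldsAboveSome (λ α → p < α * q)
fixed<scaled-holdsAbove {p} 0≤p q with 0ℚ <? q
... | yes 0<q = p ÷ q , ÷-nonNeg q 0≤p , λ α _ _ → <*⇔÷< q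
  where
    instance
      q>0 = positive 0<q
      q≢0 = pos⇒nonZero q
... | no 0≮q = never-holdsAbove λ α 0≤α p<αq → <⇒≱ p<αq (≤-trans (αq≤0 0≤α) 0≤p)
  where
    αq≤0 : ∀ {α} → 0ℚ ≤ α → α * q ≤ 0ℚ
    αq≤0 {α} 0≤α =
      subst (α * q ≤_) (*-zeroʳ α) (*-monoˡ-≤-nonNeg α {{nonNegative 0≤α}} (≮⇒≥ 0≮q))

scaled<fixed-holdsBelow : ∀ {p q} → 0ℚ ≤ p → 0ℚ ≤ q → HoldsBelowSome (λ α → α * p < q)
scaled<fixed-holdsBelow {p} {q} 0≤p 0≤q with 0ℚ <? p
... | yes 0<p = q ÷ p , ÷-nonNeg p 0≤q , λ α _ _ → *<⇔<÷ p
  where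
    instance
      p>0 = positive 0<p
      p≢0 = pos⇒nonZero p
... | no 0≮p = constant-holdsBelow (0ℚ <? q) λ α →
  mk⇔ (subst (_< q) (αp≡0 α)) (subst (_< q) (sym (αp≡0 α)))
  where
    αp≡0 : ∀ α → α * p ≡ 0ℚ
    αp≡0 α = trans (cong (α *_) (≤-antisym (≮⇒≥ 0≮p) 0≤p)) (*-zeroʳ α)

fixed<fixed-holdsBelow : ∀ p q → HoldsBelowSome (λ _ → p < q)
fixed<fixed-holdsBelow p q = constant-holdsBelow (p <? q) λ _ → mk⇔ (λ p<q → p<q) (λ p<q → p<q)

complement-holdsAbove : HoldsAboveSome P →
                        ∃[ a ] (0ℚ ≤ a × a ≤ 1ℚ × HoldsUpTo a (λ α → ¬ P α))
complement-holdsAbove (b , 0≤b , holds) =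
  b ⊓ 1ℚ , ⊓-glb 0≤b 0≤1 , p⊓q≤q b 1ℚ , λ α 0≤α α≤1 →
  mk⇔ (λ ¬Pα → ⊓-glb (≮⇒≥ (¬Pα ∘ Equivalence.from (holds α 0≤α α≤1))) α≤1)
      (λ α≤b⊓1 Pα → <⇒≱ (Equivalence.to (holds α 0≤α α≤1) Pα) (≤-trans α≤b⊓1 (p⊓q≤p b 1ℚ)))

complement-holdsBelow : HoldsBelowSome P →
                        (∃[ a ] (0ℚ ≤ a × a ≤ 1ℚ × HoldsFrom a (λ α → ¬ P α))) ⊎
                        (∀ α → 0ℚ ≤ α → α ≤ 1ℚ → P α)
complement-holdsBelow (b , 0≤b , holds) with b ≤? 1ℚ
... | yes b≤1 = inj₁ (b , 0≤b , b≤1 , λ α 0≤α α≤1 →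
  mk⇔ (λ ¬Pα → ≮⇒≥ (¬Pα ∘ Equivalence.from (holds α 0≤α α≤1)))
      (λ b≤α Pα → <⇒≱ (Equivalence.to (holds α 0≤α α≤1) Pα) b≤α))
... | no b≰1 = inj₂ λ α 0≤α α≤1 →
  Equivalence.from (holds α 0≤α α≤1) (≤-<-trans α≤1 (≰⇒> b≰1))

module EdgeFamilies (G : Graph) where

  open Walks G
  open Bottlenecks G ≤-decTotalOrder
  -- Ordered by ≥: here `AtMost c b` consists of the edges x with b ≤ c x.
  module Reversed = Bottlenecks G (Flip.decTotalOrder ≤-decTotalOrder)

  private
    variable
      u v : Fin (n G)

  growing-family-connects : u ≢ v → Reach G (allEdges G) u v → (L : ℚ → EdgeSet G) →
                            (∀ x → HoldsAboveSome (λ α → x ∈E L α)) →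
                            HoldsAboveSome (λ α → Reach G (L α) u v)
  growing-family-connects {u} {v} u≢v r L cut with bottleneck (proj₁ ∘ cut) u≢v r
  ... | x₀ , x₀-connects , lightest = c x₀ , proj₁ (proj₂ (cut x₀)) , λ α 0≤α α≤1 →
    mk⇔ (only-if α 0≤α α≤1) (if α 0≤α α≤1)
    where
      c : Fin (m G) → ℚ
      c = proj₁ ∘ cut
      enters : ∀ x → HoldsAbove (c x) (λ α → x ∈E L α)
      enters = proj₂ ∘ proj₂ ∘ cut
      only-if : ∀ α → 0ℚ ≤ α → α ≤ 1ℚ → Reach G (L α) u v → c x₀ < α
      only-if α 0≤α α≤1 r with lightest r
      ... | x , x∈ , cx₀≤cx = ≤-<-trans cx₀≤cx (Equivalence.to (enters x α 0≤α α≤1) x∈)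
      if : ∀ α → 0ℚ ≤ α → α ≤ 1ℚ → c x₀ < α → Reach G (L α) u v
      if α 0≤α α≤1 cx₀<α = Reach-mono (λ x x∈ → Equivalence.from (enters x α 0≤α α≤1)
                                                 (≤-<-trans (AtMost⁻ c x x∈) cx₀<α))
                                      x₀-connects

  shrinking-family-connects : u ≢ v → Reach G (allEdges G) u v → (L : ℚ → EdgeSet G) →
                              (∀ x → HoldsBelowSome (λ α → x ∈E L α)) →
                              HoldsBelowSome (λ α → Reach G (L α) u v)
  shrinking-family-connects {u} {v} u≢v r L cut with Reversed.bottleneck (proj₁ ∘ cut) u≢v r
  ... | x₀ , x₀-connects , heaviest = c x₀ , proj₁ (proj₂ (cut x₀)) , λ α 0≤α α≤1 →
    mk⇔ (only-if α 0≤α α≤1) (if α 0≤α α≤1)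
    where
      c : Fin (m G) → ℚ
      c = proj₁ ∘ cut
      leaves : ∀ x → HoldsBelow (c x) (λ α → x ∈E L α)
      leaves = proj₂ ∘ proj₂ ∘ cut
      only-if : ∀ α → 0ℚ ≤ α → α ≤ 1ℚ → Reach G (L α) u v → α < c x₀
      only-if α 0≤α α≤1 r with heaviest r
      ... | x , x∈ , cx≤cx₀ = <-≤-trans (Equivalence.to (leaves x α 0≤α α≤1) x∈) cx≤cx₀
      if : ∀ α → 0ℚ ≤ α → α ≤ 1ℚ → α < c x₀ → Reach G (L α) u v
      if α 0≤α α≤1 α<cx₀ = Reach-mono (λ x x∈ → Equivalence.from (leaves x α 0≤α α≤1)
                                                 (<-≤-trans α<cx₀ (Reversed.AtMost⁻ c x x∈)))
                                      x₀-connects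

module Thresholds (G : Graph) (w : Fin (m G) → ℚ) (w≥0 : ∀ e → 0ℚ ≤ w e)
                  (safe : Fin (m G) → Bool) where

  open EdgeFamilies G
  module MSTα (α : ℚ) = MinimumSpanningTrees G (wα G w safe α)
  open MSTα using (Lighter; ∈Lighter⇔; InSomeMST⇒no-lighter-path; InSomeMST⇔no-lighter-path)

  private
    variable
      α p q : ℚ
      e f x : Fin (m G)

  wα-safe : ∀ α → safe x ≡ true → wα G w safe α x ≡ α * w x
  wα-safe α x-safe rewrite x-safe = refl

  wα-unsafe : ∀ α → safe x ≡ false → wα G w safe α x ≡ w x
  wα-unsafe α x-unsafe rewrite x-unsafe = refl

  ∈Lighter⇔′ : ∀ α → wα G w safe α x ≡ p → wα G w safe α e ≡ q →
               x ∈E Lighter α e ⇔ p < q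
  ∈Lighter⇔′ α refl refl = ∈Lighter⇔ α

  lighter-than-safe : safe e ≡ true → ∀ x → HoldsAboveSome (λ α → x ∈E Lighter α e)
  lighter-than-safe {e} e-safe x = by-kind (safe x) refl
    where
      by-kind : ∀ b → safe x ≡ b → HoldsAboveSome (λ α → x ∈E Lighter α e)
      by-kind true x-safe = HoldsAboveSome-resp
        (λ α → ∈Lighter⇔′ α (wα-safe α x-safe) (wα-safe α e-safe))
        (scaled<scaled-holdsAbove (w x) (w e))
      by-kind false x-unsafe = HoldsAboveSome-resp
        (λ α → ∈Lighter⇔′ α (wα-unsafe α x-unsafe) (wα-safe α e-safe))
        (fixed<scaled-holdsAbove (w≥0 x) (w e))

  lighter-than-unsafe : safe f ≡ false → ∀ x → HoldsBelowSome (λ α → x ∈E Lighter α f)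
  lighter-than-unsafe {f} f-unsafe x = by-kind (safe x) refl
    where
      by-kind : ∀ b → safe x ≡ b → HoldsBelowSome (λ α → x ∈E Lighter α f)
      by-kind true x-safe = HoldsBelowSome-resp
        (λ α → ∈Lighter⇔′ α (wα-safe α x-safe) (wα-unsafe α f-unsafe))
        (scaled<fixed-holdsBelow (w≥0 x) (w≥0 f))
      by-kind false x-unsafe = HoldsBelowSome-resp
        (λ α → ∈Lighter⇔′ α (wα-unsafe α x-unsafe) (wα-unsafe α f-unsafe))
        (fixed<fixed-holdsBelow (w x) (w f))

  upper-threshold : Loopless G → Connected G → ∀ e → safe e ≡ true → ∃[ a ] UpperThreshold G w safe e a
  upper-threshold loopless connected e e-safe
    with complement-holdsAbove (growing-family-connects (loopless e) (connected _ _) (λ α → Lighter α e)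
                                                         (lighter-than-safe e-safe))
  ... | a , 0≤a , a≤1 , separated⇔ = a , (0≤a , a≤1) , λ α (0≤α , α≤1) →
    let in-mst⇔ = separated⇔ α 0≤α α≤1 ⇔-∘ InSomeMST⇔no-lighter-path α connected
    in Equivalence.to in-mst⇔ , Equivalence.from in-mst⇔

  lower-threshold : Loopless G → Connected G → ∀ f → safe f ≡ false →
                    (∃[ a ] LowerThreshold G w safe f a) ⊎ LowerThresholdInfinite G w safe f
  lower-threshold loopless connected f f-unsafe
    with complement-holdsBelow (shrinking-family-connects (loopless f) (connected _ _)
                                                           (λ α → Lighter α f) (lighter-than-unsafe f-unsafe))
  ... | inj₁ (a , 0≤a , a≤1 , separated⇔) = inj₁ (a , (0≤a , a≤1) , λ α (0≤α , α≤1) →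
    let in-mst⇔ = separated⇔ α 0≤α α≤1 ⇔-∘ InSomeMST⇔no-lighter-path α connected
    in Equivalence.to in-mst⇔ , Equivalence.from in-mst⇔)
  ... | inj₂ always-connected = inj₂ λ α (0≤α , α≤1) in-mst →
    InSomeMST⇒no-lighter-path α in-mst (always-connected α 0≤α α≤1)

lemma2 : (G : Graph) → Loopless G → Connected G →
         (w : Fin (m G) → ℚ) → (∀ e → 0ℚ ≤ w e) →
         (safe : Fin (m G) → Bool) →
         ((f : Fin (m G)) → safe f ≡ false →
            (∃[ a ] LowerThreshold G w safe f a) ⊎ LowerThresholdInfinite G w safe f)
         × ((e : Fin (m G)) → safe e ≡ true → ∃[ a ] UpperThreshold G w safe e a)
lemma2 G loopless connected w w≥0 safe =
  lower-threshold loopless connected , upper-threshold loopless connected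
  where open Thresholds G w w≥0 safe
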